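{- Let $n$ and $m$ be positive integers with $m\geq n+1$, let $P=(x_1,y_1)\cdots(x_{n+1},y_{n+1})$ be an $(n,m)$-lattice path, and let $\Gamma=\Gamma_P:\{1,\ldots,m\}\to\mathcal{PL}(P)$ be as defined in the context. Then $PRML(\Gamma(r))=r-1$ for every $r\in\{1,\ldots,m\}$.
   Context: An $(n,m)$-lattice path is a sequence $Q=(u_1,v_1)\cdots(u_{n+1},v_{n+1})$ of vectors in $\mathbb{Z}^2$ such that $1-n\leq v_i\leq 1$, $\sum_i v_i=1$, $1\leq u_i\leq m-1$, $\sum_i u_i=m$. For such $Q$ put $a_0=b_0=0$, $a_i=\sum_{k=1}^{i}v_k$, $b_i=\sum_{k=1}^{i}u_k$; a minimum point is a point $(b_i,a_i)$ with $a_i\leq a_k$ for all $k\in\{0,\ldots,n+1\}$; the rightmost minimum point is the minimum point with largest $b_i$, and if it is $(b_i,a_i)$ then $RML(Q)=b_i$. A pointed $(n,m)$-lattice path is a pair $\dot{Q}=[Q;j]$ with $0\leq j\leq u_{n+1}-1$; its pointed rightmost minimum length is $PRML(\dot{Q})=RML(Q)+j$. For $P$ as in the claim and $i\in\{1,\ldots,n+1\}$, let $P_i=(x_{i+1},y_{i+1})\cdots(x_{n+1},y_{n+1})(x_1,y_1)\cdots(x_i,y_i)$ (so $P_{n+1}=P$), and $\dot{P}(i;j)=[P_i;j]$ for $0\leq j\leq x_i-1$; $\mathcal{PL}(P)=\{\dot{P}(i;j)\mid i\in\{1,\ldots,n+1\},\ 0\leq j\leq x_i-1\}$ (one element for each such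 pair $(i,j)$, $m$ in total). Let $s_i=\sum_{k=1}^{i}y_k$ and define a linear order $<_P$ on $\{1,\ldots,n+1\}$ by $i<_P j$ iff $s_i<s_j$, or $s_i=s_j$ and $i>j$. Let $i_0$ be the $<_P$-smallest element of $\{1,\ldots,n+1\}$ and let $\sigma_P=(\sigma_P(1),\ldots,\sigma_P(n+1))=(i_0,i_0-1,\ldots,1,n+1,n,\ldots,i_0+1)$. Define a linear order $\prec^*_P$ on $\mathcal{PL}(P)$ by $\dot{P}(i_1;j_1)\prec^*_P\dot{P}(i_2;j_2)$ iff either $\sigma_P^{ -1}(i_1)<\sigma_P^{ -1}(i_2)$, or $i_1=i_2$ and $j_1<j_2$. Let $\Gamma_P(r)$ be the $r$-th element of $\mathcal{PL}(P)$ in increasing $\prec^*_P$-order, for $r=1,\ldots,m$. -}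

module Defs where

open import Data.Nat as ℕ using (ℕ; zero; suc; _∸_; _⊔_)
open import Data.Integer as ℤ using (ℤ; +_; _⊓_)
open import Data.List using (List; []; _∷_; _++_; map; foldr; filter; upTo; length; take; drop; concatMap; reverse)
open import Data.List.Relation.Unary.All using (All)
open import Data.Product using (_×_; _,_; proj₁; proj₂)
open import Relation.Binary.PropositionalEquality using (_≡_)

-- A step (u , v) : u ∈ ℕ (horizontal), v ∈ ℤ (vertical).
Step : Set
Step = ℕ × ℤ

Path : Set
Path = List Step

sumℤ : List ℤ → ℤ
sumℤ = foldr ℤ._+_ (+ 0)

sumℕ : List ℕ → ℕ
sumℕ = foldr ℕ._+_ 0

record IsLatticePath (n m : ℕ) (Q : Path) : Set where
  field
    len   : length Q ≡ suc n
    vLow  : All (λ s → (+ 1 ℤ.- + n) ℤ.≤ proj₂ s) Q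
    vHigh : All (λ s → proj₂ s ℤ.≤ + 1) Q
    vSum  : sumℤ (map proj₂ Q) ≡ + 1
    uLow  : All (λ s → 1 ℕ.≤ proj₁ s) Q
    uHigh : All (λ s → proj₁ s ℕ.≤ m ∸ 1) Q
    uSum  : sumℕ (map proj₁ Q) ≡ m

pointsFrom : ℕ → ℤ → Path → List (ℕ × ℤ)
pointsFrom b a [] = (b , a) ∷ []
pointsFrom b a ((u , v) ∷ Q) = (b , a) ∷ pointsFrom (b ℕ.+ u) (a ℤ.+ v) Q

points : Path → List (ℕ × ℤ)
points = pointsFrom 0 (+ 0)

minℤ : ℤ → List ℤ → ℤ
minℤ = foldr _⊓_

RML : Path → ℕ
RML Q = foldr _⊔_ 0 (map proj₁ (filter (λ p → proj₂ p ℤ.≟ amin) pts))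
  where
  pts  = points Q
  amin = minℤ (+ 0) (map proj₂ pts)

record Pointed : Set where
  constructor [_︔_]
  field
    path : Path
    pt   : ℕ

PRML : Pointed → ℕ
PRML [ Q ︔ j ] = RML Q ℕ.+ j

rot : ℕ → Path → Path
rot i P = drop i P ++ take i P

-- the i-th step (1-indexed), with a default outside the range
stepAt : ℕ → Path → Step
stepAt _ [] = (0 , + 0)
stepAt zero (s ∷ _) = s
stepAt (suc zero) (s ∷ _) = s
stepAt (suc (suc i)) (_ ∷ P) = stepAt (suc i) P

sPref : Path → ℕ → ℤ
sPref P i = sumℤ (map proj₂ (take i P))

indices : ℕ → List ℕ
indices N = map suc (upTo N)

-- i_0: the <_P-smallest index, i.e. among the indices with minimal s_i
-- the largest one.
i₀ : Path → ℕ
i₀ P = foldr _⊔_ 0 (filter (λ i → sPref P i ℤ.≟ smin) (indices (length P)))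
  where
  smin = minℤ (sPref P 1) (map (sPref P) (indices (length P)))

σ : Path → List ℕ
σ P = map (λ k → i₀ P ∸ k) (upTo (i₀ P))
   ++ map (λ k → length P ∸ k) (upTo (length P ∸ i₀ P))

-- 𝒫ℒ(P) listed in increasing ≺*_P order: Γ_P(r) is the r-th entry.
Γ : Path → List Pointed
Γ P = concatMap (λ i → map (λ j → [ rot i P ︔ j ]) (upTo (proj₁ (stepAt i P)))) (σ P)

-- Let s t be the height after the first t steps of P, and continue these prefix sums
-- along the doubled path P ++ P, where s (N + t) = s t + 1 because P closes at height 1.
-- The rotation P_i sees exactly the window s i, …, s (i + N), shifted by s i, so its
-- rightmost minimum is the rightmost minimum of that window.  As i₀ is the rightmost
-- minimum of s 1, …, s N, the window minimum sits at i₀ when i ≤ i₀ and at N + i₀ when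
-- i > i₀: RML (P_i) is the width of the cyclic stretch of steps i + 1, …, i₀.  Hence,
-- visiting i₀, i₀ - 1, …, 1, N, …, i₀ + 1, each block RML (P_i) + [0, x_i) starts where
-- the previous one ended, and together they enumerate 0, …, m - 1.

module Submission where

open import Defs
open import Data.Nat as ℕ using (ℕ; zero; suc; _≤_; _<_; _+_; _∸_; _⊔_; z≤n; s≤s)
import Data.Nat.Properties as ℕₚ
open import Data.Integer as ℤ using (ℤ; +0; 1ℤ; _⊓_)
import Data.Integer.Properties as ℤₚ
open import Data.List using (List; []; _∷_; _++_; map; foldr; filter; upTo; applyUpTo; length; take; drop; concatMap)
open import Data.List.Properties
  using (foldr-preservesᵇ; length-++; length-drop; length-take; take-all; drop-all; take-take;
         map-applyUpTo; map-cong; map-∘; map-++; map-id; map-concatMap; concatMap-map; concatMap-cong)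
open import Data.List.Membership.Propositional using (_∈_)
open import Data.List.Membership.Propositional.Properties
  using (foldr-selective; ∈-map⁺; ∈-map⁻; ∈-filter⁺; ∈-filter⁻; ∈-upTo⁺; ∈-upTo⁻)
open import Data.List.Relation.Unary.Any using (here; there)
import Data.List.Relation.Unary.All as All
open import Data.Product using (_×_; _,_; proj₁; proj₂; ∃-syntax)
open import Data.Sum using (inj₁; inj₂)
open import Relation.Binary.PropositionalEquality
  using (_≡_; refl; sym; trans; cong; cong₂; subst; subst₂; module ≡-Reasoning)
open import Relation.Nullary using (contradiction; yes; no)
open import Function using (_∘_)

≤-max : ∀ {x} xs → x ∈ xs → x ≤ foldr _⊔_ 0 xs
≤-max (y ∷ ys) (here refl) = ℕₚ.m≤m⊔n y _
≤-max (y ∷ ys) (there x∈ys) = ℕₚ.m≤n⇒m≤o⊔n y (≤-max ys x∈ys)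

max-≤ : ∀ {b} xs → (∀ {x} → x ∈ xs → x ≤ b) → foldr _⊔_ 0 xs ≤ b
max-≤ xs bounded = foldr-preservesᵇ ℕₚ.⊔-lub z≤n (All.tabulate bounded)

max-∈ : ∀ {x} xs → x ∈ xs → foldr _⊔_ 0 xs ∈ xs
max-∈ {x} xs x∈xs with foldr-selective ℕₚ.⊔-sel 0 xs
... | inj₂ max∈xs = max∈xs
... | inj₁ max≡0 = subst (_∈ xs) (trans x≡0 (sym max≡0)) x∈xs
  where
  x≡0 : x ≡ 0
  x≡0 = ℕₚ.n≤0⇒n≡0 (subst (x ≤_) max≡0 (≤-max xs x∈xs))

min-≤ : ∀ c {x} xs → x ∈ xs → foldr _⊓_ c xs ℤ.≤ x
min-≤ c (y ∷ ys) (here refl) = ℤₚ.i⊓j≤i y _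
min-≤ c (y ∷ ys) (there x∈ys) = ℤₚ.i≤j⇒k⊓i≤j y (min-≤ c ys x∈ys)

rightmost : List (ℕ × ℤ) → ℤ → ℕ
rightmost ps a = foldr _⊔_ 0 (map proj₁ (filter (λ p → proj₂ p ℤ.≟ a) ps))

rightmost-≡ : ∀ ps a {b} → (b , a) ∈ ps → (∀ {p} → p ∈ ps → proj₂ p ≡ a → proj₁ p ≤ b) →
  rightmost ps a ≡ b
rightmost-≡ ps a {b} b∈ps left = ℕₚ.≤-antisym (max-≤ _ bound) (≤-max _ b∈)
  where
  b∈ : b ∈ map proj₁ (filter (λ p → proj₂ p ℤ.≟ a) ps)
  b∈ = ∈-map⁺ proj₁ (∈-filter⁺ (λ p → proj₂ p ℤ.≟ a) b∈ps refl)
  bound : ∀ {x} → x ∈ map proj₁ (filter (λ p → proj₂ p ℤ.≟ a) ps) → x ≤ b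
  bound x∈ with ∈-map⁻ proj₁ x∈
  ... | p , p∈ , refl = let p∈ps , pa = ∈-filter⁻ (λ p → proj₂ p ℤ.≟ a) p∈ in left p∈ps pa

width : Path → ℕ
width X = sumℕ (map proj₁ X)

height : Path → ℤ
height X = sumℤ (map proj₂ X)

width-++ : ∀ X Y → width (X ++ Y) ≡ width X + width Y
width-++ [] Y = refl
width-++ ((u , _) ∷ X) Y = trans (cong (_+_ u) (width-++ X Y)) (sym (ℕₚ.+-assoc u (width X) (width Y)))

height-++ : ∀ X Y → height (X ++ Y) ≡ height X ℤ.+ height Y
height-++ [] Y = sym (ℤₚ.+-identityˡ (height Y))
height-++ ((_ , v) ∷ X) Y = trans (cong (ℤ._+_ v) (height-++ X Y)) (sym (ℤₚ.+-assoc v (height X) (height Y)))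

width-take-mono : ∀ {j k} X → j ≤ k → width (take j X) ≤ width (take k X)
width-take-mono X z≤n = z≤n
width-take-mono [] (s≤s j≤k) = z≤n
width-take-mono ((u , _) ∷ X) (s≤s j≤k) = ℕₚ.+-monoʳ-≤ u (width-take-mono X j≤k)

width-take-suc : ∀ t X → width (take (suc t) X) ≡ width (take t X) + proj₁ (stepAt (suc t) X)
width-take-suc zero [] = refl
width-take-suc (suc t) [] = refl
width-take-suc zero ((u , _) ∷ X) = ℕₚ.+-identityʳ u
width-take-suc (suc t) ((u , _) ∷ X) =
  trans (cong (_+_ u) (width-take-suc t X)) (sym (ℕₚ.+-assoc u _ _))

pointAt : ℕ → ℤ → Path → ℕ → ℕ × ℤ
pointAt b a Q j = b + width (take j Q) , a ℤ.+ height (take j Q)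

pointAt-zero : ∀ b a Q → pointAt b a Q 0 ≡ (b , a)
pointAt-zero b a Q = cong₂ _,_ (ℕₚ.+-identityʳ b) (ℤₚ.+-identityʳ a)

pointAt-suc : ∀ b a u v Q j → pointAt b a ((u , v) ∷ Q) (suc j) ≡ pointAt (b + u) (a ℤ.+ v) Q j
pointAt-suc b a u v Q j =
  sym (cong₂ _,_ (ℕₚ.+-assoc b u (width (take j Q))) (ℤₚ.+-assoc a v (height (take j Q))))

head-∈-pointsFrom : ∀ b a Q → (b , a) ∈ pointsFrom b a Q
head-∈-pointsFrom b a [] = here refl
head-∈-pointsFrom b a (_ ∷ _) = here refl

∈-pointsFrom⁺ : ∀ b a Q {j} → j ≤ length Q → pointAt b a Q j ∈ pointsFrom b a Q
∈-pointsFrom⁺ b a Q {zero} _ = subst (_∈ pointsFrom b a Q) (sym (pointAt-zero b a Q)) (head-∈-pointsFrom b a Q)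
∈-pointsFrom⁺ b a ((u , v) ∷ Q) {suc j} (s≤s j≤) =
  there (subst (_∈ pointsFrom (b + u) (a ℤ.+ v) Q) (sym (pointAt-suc b a u v Q j))
               (∈-pointsFrom⁺ (b + u) (a ℤ.+ v) Q j≤))

∈-pointsFrom⁻ : ∀ b a Q {p} → p ∈ pointsFrom b a Q → ∃[ j ] j ≤ length Q × p ≡ pointAt b a Q j
∈-pointsFrom⁻ b a [] (here p≡) = 0 , z≤n , trans p≡ (sym (pointAt-zero b a []))
∈-pointsFrom⁻ b a (s ∷ Q) (here p≡) = 0 , z≤n , trans p≡ (sym (pointAt-zero b a (s ∷ Q)))
∈-pointsFrom⁻ b a ((u , v) ∷ Q) (there p∈) with ∈-pointsFrom⁻ (b + u) (a ℤ.+ v) Q p∈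
... | j , j≤ , p≡ = suc j , s≤s j≤ , trans p≡ (sym (pointAt-suc b a u v Q j))

pointAt-origin : ∀ Q j → pointAt 0 +0 Q j ≡ (width (take j Q) , height (take j Q))
pointAt-origin Q j = cong (width (take j Q) ,_) (ℤₚ.+-identityˡ (height (take j Q)))

∈-points⁺ : ∀ Q {j} → j ≤ length Q → (width (take j Q) , height (take j Q)) ∈ points Q
∈-points⁺ Q {j} j≤ = subst (_∈ points Q) (pointAt-origin Q j) (∈-pointsFrom⁺ 0 +0 Q j≤)

∈-points⁻ : ∀ Q {p} → p ∈ points Q → ∃[ j ] j ≤ length Q × p ≡ (width (take j Q) , height (take j Q))
∈-points⁻ Q p∈ with ∈-pointsFrom⁻ 0 +0 Q p∈
... | j , j≤ , p≡ = j , j≤ , trans p≡ (pointAt-origin Q j)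

RML-take : ∀ Q {k} → k ≤ length Q →
  (∀ {j} → j ≤ length Q → height (take k Q) ℤ.≤ height (take j Q)) →
  (∀ {j} → k < j → j ≤ length Q → height (take k Q) ℤ.< height (take j Q)) →
  RML Q ≡ width (take k Q)
RML-take Q {k} k≤ lowest strict = begin
  RML Q                                    ≡⟨ cong (rightmost (points Q)) minimum ⟩
  rightmost (points Q) (height (take k Q)) ≡⟨ rightmost-≡ (points Q) _ (∈-points⁺ Q k≤) rightmost-at ⟩
  width (take k Q)                         ∎
  where
  open ≡-Reasoning
  hₖ : ℤ
  hₖ = height (take k Q)
  below : hₖ ℤ.≤ minℤ +0 (map proj₂ (points Q))
  below with foldr-selective ℤₚ.⊓-sel +0 (map proj₂ (points Q))
  ... | inj₁ min≡0 = subst (hₖ ℤ.≤_) (sym min≡0) (lowest z≤n)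
  ... | inj₂ min∈ with ∈-map⁻ proj₂ min∈
  ...   | p , p∈ , min≡ with ∈-points⁻ Q p∈
  ...     | j , j≤ , refl = subst (hₖ ℤ.≤_) (sym min≡) (lowest j≤)
  minimum : minℤ +0 (map proj₂ (points Q)) ≡ hₖ
  minimum = ℤₚ.≤-antisym (min-≤ +0 _ (∈-map⁺ proj₂ (∈-points⁺ Q k≤))) below
  rightmost-at : ∀ {p} → p ∈ points Q → proj₂ p ≡ hₖ → proj₁ p ≤ width (take k Q)
  rightmost-at p∈ hₚ≡hₖ with ∈-points⁻ Q p∈
  ... | j , j≤ , refl with j ℕ.≤? k
  ...   | yes j≤k = width-take-mono Q j≤k
  ...   | no j≰k = contradiction (sym hₚ≡hₖ) (ℤₚ.<⇒≢ (strict (ℕₚ.≰⇒> j≰k) j≤))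

record IsRightmostMinimum (f : ℕ → ℤ) (xs : List ℕ) (I : ℕ) : Set where
  field
    member  : I ∈ xs
    minimal : ∀ {t} → t ∈ xs → f I ℤ.≤ f t
    strict  : ∀ {t} → t ∈ xs → I < t → f I ℤ.< f t

rightmostArgmin : (ℕ → ℤ) → ℕ → List ℕ → ℕ
rightmostArgmin f d xs = foldr _⊔_ 0 (filter (λ i → f i ℤ.≟ minℤ (f d) (map f xs)) xs)

rightmostArgmin-isRightmostMinimum : ∀ f {d} xs → d ∈ xs →
  IsRightmostMinimum f xs (rightmostArgmin f d xs)
rightmostArgmin-isRightmostMinimum f {d} xs d∈xs = record
  { member = proj₁ I-at-min ; minimal = minimal ; strict = strict }
  where
  a : ℤ
  a = minℤ (f d) (map f xs)
  at-min : List ℕ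
  at-min = filter (λ i → f i ℤ.≟ a) xs
  I : ℕ
  I = foldr _⊔_ 0 at-min
  some-at-min : ∃[ t ] t ∈ at-min
  some-at-min with foldr-selective ℤₚ.⊓-sel (f d) (map f xs)
  ... | inj₁ a≡fd = d , ∈-filter⁺ (λ i → f i ℤ.≟ a) d∈xs (sym a≡fd)
  ... | inj₂ a∈ with ∈-map⁻ f a∈
  ...   | t , t∈xs , a≡ft = t , ∈-filter⁺ (λ i → f i ℤ.≟ a) t∈xs (sym a≡ft)
  I-at-min : I ∈ xs × f I ≡ a
  I-at-min = ∈-filter⁻ (λ i → f i ℤ.≟ a) (max-∈ at-min (proj₂ some-at-min))
  minimal : ∀ {t} → t ∈ xs → f I ℤ.≤ f t
  minimal t∈xs = subst (ℤ._≤ _) (sym (proj₂ I-at-min)) (min-≤ (f d) (map f xs) (∈-map⁺ f t∈xs))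
  strict : ∀ {t} → t ∈ xs → I < t → f I ℤ.< f t
  strict t∈xs I<t = ℤₚ.≤∧≢⇒< (minimal t∈xs) λ fI≡ft →
    ℕₚ.<⇒≱ I<t (≤-max at-min (∈-filter⁺ (λ i → f i ℤ.≟ a) t∈xs (trans (sym fI≡ft) (proj₂ I-at-min))))

∈-indices⁺ : ∀ {n t} → 1 ≤ t → t ≤ n → t ∈ indices n
∈-indices⁺ {t = suc t} _ t≤n = ∈-map⁺ suc (∈-upTo⁺ t≤n)

∈-indices⁻ : ∀ {n t} → t ∈ indices n → 1 ≤ t × t ≤ n
∈-indices⁻ t∈ with ∈-map⁻ suc t∈
... | k , k∈ , refl = s≤s z≤n , ∈-upTo⁻ k∈

i₀-isRightmostMinimum : ∀ P → 1 ≤ length P → IsRightmostMinimum (sPref P) (indices (length P)) (i₀ P)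
i₀-isRightmostMinimum P nonempty =
  rightmostArgmin-isRightmostMinimum (sPref P) _ (∈-indices⁺ ℕₚ.≤-refl nonempty)

module _ {A : Set} where

  take-++ˡ : ∀ {n} (xs ys : List A) → n ≤ length xs → take n (xs ++ ys) ≡ take n xs
  take-++ˡ {zero} xs ys _ = refl
  take-++ˡ {suc n} (x ∷ xs) ys (s≤s n≤) = cong (x ∷_) (take-++ˡ xs ys n≤)

  take-+-++ : ∀ i j (xs ys : List A) → i ≤ length xs →
    take (i + j) (xs ++ ys) ≡ take i xs ++ take j (drop i xs ++ ys)
  take-+-++ zero j xs ys _ = refl
  take-+-++ (suc i) j (x ∷ xs) ys (s≤s i≤) = cong (x ∷_) (take-+-++ i j xs ys i≤)

  take-++-take : ∀ j k (xs ys : List A) → j ≤ length xs + k →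
    take j (xs ++ ys) ≡ take j (xs ++ take k ys)
  take-++-take j k [] ys j≤k =
    sym (trans (take-take j k ys) (cong (λ n → take n ys) (ℕₚ.m≤n⇒m⊓n≡m j≤k)))
  take-++-take zero k (x ∷ xs) ys _ = refl
  take-++-take (suc j) k (x ∷ xs) ys (s≤s j≤) = cong (x ∷_) (take-++-take j k xs ys j≤)

  take-length-+ : ∀ t (xs : List A) → take (length xs + t) (xs ++ xs) ≡ xs ++ take t xs
  take-length-+ t xs = begin
    take (length xs + t) (xs ++ xs)                 ≡⟨ take-+-++ (length xs) t xs xs ℕₚ.≤-refl ⟩
    take (length xs) xs ++ take t (drop (length xs) xs ++ xs)
      ≡⟨ cong₂ (λ as bs → as ++ take t (bs ++ xs))
               (take-all (length xs) xs ℕₚ.≤-refl) (drop-all (length xs) xs ℕₚ.≤-refl) ⟩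
    xs ++ take t xs                                 ∎
    where open ≡-Reasoning

length-rot : ∀ i (xs : Path) → i ≤ length xs → length (rot i xs) ≡ length xs
length-rot i xs i≤ = begin
  length (drop i xs ++ take i xs)       ≡⟨ length-++ (drop i xs) ⟩
  length (drop i xs) + length (take i xs)
    ≡⟨ cong₂ _+_ (length-drop i xs) (trans (length-take i xs) (ℕₚ.m≤n⇒m⊓n≡m i≤)) ⟩
  (length xs ∸ i) + i                   ≡⟨ ℕₚ.m∸n+n≡m i≤ ⟩
  length xs                             ∎
  where open ≡-Reasoning

take-rot : ∀ i j (xs : Path) → i ≤ length xs → j ≤ length xs →
  take (i + j) (xs ++ xs) ≡ take i (xs ++ xs) ++ take j (rot i xs)
take-rot i j xs i≤ j≤ = begin
  take (i + j) (xs ++ xs)                    ≡⟨ take-+-++ i j xs xs i≤ ⟩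
  take i xs ++ take j (drop i xs ++ xs)
    ≡⟨ cong₂ _++_ (sym (take-++ˡ xs xs i≤)) (take-++-take j i (drop i xs) xs j≤′) ⟩
  take i (xs ++ xs) ++ take j (rot i xs)     ∎
  where
  open ≡-Reasoning
  j≤′ : j ≤ length (drop i xs) + i
  j≤′ = subst (j ≤_) (sym (trans (cong (_+ i) (length-drop i xs)) (ℕₚ.m∸n+n≡m i≤))) j≤

+-cancelˡ-≤ : ∀ i {j k} → i ℤ.+ j ℤ.≤ i ℤ.+ k → j ℤ.≤ k
+-cancelˡ-≤ i {j} {k} = subst₂ ℤ._≤_ (-i+[i+j]≡j j) (-i+[i+j]≡j k) ∘ ℤₚ.+-monoʳ-≤ (ℤ.- i)
  where
  -i+[i+j]≡j : ∀ j → ℤ.- i ℤ.+ (i ℤ.+ j) ≡ j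
  -i+[i+j]≡j j = trans (sym (ℤₚ.+-assoc (ℤ.- i) i j))
    (trans (cong (ℤ._+ j) (ℤₚ.+-inverseˡ i)) (ℤₚ.+-identityˡ j))

+-cancelˡ-< : ∀ i {j k} → i ℤ.+ j ℤ.< i ℤ.+ k → j ℤ.< k
+-cancelˡ-< i {j} {k} i+j<i+k =
  ℤₚ.≤∧≢⇒< (+-cancelˡ-≤ i (ℤₚ.<⇒≤ i+j<i+k)) (ℤₚ.<⇒≢ i+j<i+k ∘ cong (ℤ._+_ i))

i<suc[i] : ∀ i → i ℤ.< ℤ.suc i
i<suc[i] i = ℤₚ.suc[i]≤j⇒i<j ℤₚ.≤-refl

cyclicHeight : Path → ℕ → ℤ
cyclicHeight P t = height (take t (P ++ P))

cyclicWidth : Path → ℕ → ℕ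
cyclicWidth P t = width (take t (P ++ P))

cyclicWidth-RML-rot : ∀ P {i q} → i ≤ length P → i ≤ q → q ≤ i + length P →
  (∀ {p} → i ≤ p → p ≤ i + length P → cyclicHeight P q ℤ.≤ cyclicHeight P p) →
  (∀ {p} → q < p → p ≤ i + length P → cyclicHeight P q ℤ.< cyclicHeight P p) →
  cyclicWidth P i + RML (rot i P) ≡ cyclicWidth P q
cyclicWidth-RML-rot P {i} {q} i≤N i≤q q≤ lowest strict = begin
  cyclicWidth P i + RML Q              ≡⟨ cong (cyclicWidth P i +_) (RML-take Q k≤ lowest′ strict′) ⟩
  cyclicWidth P i + width (take k Q)   ≡⟨ sym (width-++ (take i (P ++ P)) (take k Q)) ⟩
  width (take i (P ++ P) ++ take k Q)  ≡⟨ cong width (sym (prefix k≤)) ⟩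
  cyclicWidth P (i + k)                ≡⟨ cong (cyclicWidth P) i+k≡q ⟩
  cyclicWidth P q                      ∎
  where
  open ≡-Reasoning
  N : ℕ
  N = length P
  Q : Path
  Q = rot i P
  k : ℕ
  k = q ∸ i
  i+k≡q : i + k ≡ q
  i+k≡q = ℕₚ.m+[n∸m]≡n i≤q
  lengthQ : length Q ≡ N
  lengthQ = length-rot i P i≤N
  k≤ : k ≤ length Q
  k≤ = subst (k ≤_) (sym lengthQ) (ℕₚ.+-cancelˡ-≤ i k N (subst (_≤ i + N) (sym i+k≡q) q≤))
  prefix : ∀ {j} → j ≤ length Q → take (i + j) (P ++ P) ≡ take i (P ++ P) ++ take j Q
  prefix {j} j≤ = take-rot i j P i≤N (subst (j ≤_) lengthQ j≤)
  window : ∀ {j} → j ≤ length Q → cyclicHeight P (i + j) ≡ cyclicHeight P i ℤ.+ height (take j Q)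
  window {j} j≤ = trans (cong height (prefix j≤)) (height-++ (take i (P ++ P)) (take j Q))
  inWindow : ∀ {j} → j ≤ length Q → i + j ≤ i + N
  inWindow j≤ = ℕₚ.+-monoʳ-≤ i (subst (_ ≤_) lengthQ j≤)
  Sq≡ : cyclicHeight P q ≡ cyclicHeight P i ℤ.+ height (take k Q)
  Sq≡ = trans (cong (cyclicHeight P) (sym i+k≡q)) (window k≤)
  lowest′ : ∀ {j} → j ≤ length Q → height (take k Q) ℤ.≤ height (take j Q)
  lowest′ j≤ = +-cancelˡ-≤ (cyclicHeight P i)
    (subst₂ ℤ._≤_ Sq≡ (window j≤) (lowest (ℕₚ.m≤m+n i _) (inWindow j≤)))
  strict′ : ∀ {j} → k < j → j ≤ length Q → height (take k Q) ℤ.< height (take j Q)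
  strict′ k<j j≤ = +-cancelˡ-< (cyclicHeight P i)
    (subst₂ ℤ._<_ Sq≡ (window j≤) (strict (subst (_< i + _) i+k≡q (ℕₚ.+-monoʳ-< i k<j)) (inWindow j≤)))

block : ℕ × ℕ → List ℕ
block (r , l) = map (r +_) (upTo l)

Tiling : ℕ → List (ℕ × ℕ) → ℕ → Set
Tiling c [] e = c ≡ e
Tiling c ((r , l) ∷ bs) e = r ≡ c × Tiling (c + l) bs e

Tiling-++ : ∀ {c d e} bs {cs} → Tiling c bs d → Tiling d cs e → Tiling c (bs ++ cs) e
Tiling-++ [] refl tiling = tiling
Tiling-++ (_ ∷ bs) (r≡c , tiling₁) tiling₂ = r≡c , Tiling-++ bs tiling₁ tiling₂

Tiling-length : ∀ {c e} bs → Tiling c bs e → c + sumℕ (map proj₂ bs) ≡ e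
Tiling-length {c} [] c≡e = trans (ℕₚ.+-identityʳ c) c≡e
Tiling-length {c} ((_ , l) ∷ bs) (_ , tiling) =
  trans (sym (ℕₚ.+-assoc c l _)) (Tiling-length bs tiling)

applyUpTo-+ : ∀ {A : Set} (f : ℕ → A) a b → applyUpTo f (a + b) ≡ applyUpTo f a ++ applyUpTo (λ j → f (a + j)) b
applyUpTo-+ f zero b = refl
applyUpTo-+ f (suc a) b = cong (f 0 ∷_) (applyUpTo-+ (λ j → f (suc j)) a b)

upTo-+ : ∀ a b → upTo (a + b) ≡ upTo a ++ map (a +_) (upTo b)
upTo-+ a b = trans (applyUpTo-+ (λ j → j) a b) (cong (upTo a ++_) (sym (map-applyUpTo (λ j → j) (a +_) b)))

block-++ : ∀ c a b → block (c , a) ++ block (c + a , b) ≡ block (c , a + b)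
block-++ c a b = begin
  map (c +_) (upTo a) ++ map (c + a +_) (upTo b)          ≡⟨ cong (map (c +_) (upTo a) ++_) (map-cong (ℕₚ.+-assoc c a) (upTo b)) ⟩
  map (c +_) (upTo a) ++ map (λ j → c + (a + j)) (upTo b) ≡⟨ cong (map (c +_) (upTo a) ++_) (map-∘ (upTo b)) ⟩
  map (c +_) (upTo a) ++ map (c +_) (map (a +_) (upTo b)) ≡⟨ sym (map-++ (c +_) (upTo a) _) ⟩
  map (c +_) (upTo a ++ map (a +_) (upTo b))              ≡⟨ cong (map (c +_)) (sym (upTo-+ a b)) ⟩
  map (c +_) (upTo (a + b))                               ∎
  where open ≡-Reasoning

concatMap-block : ∀ {c e} bs → Tiling c bs e → concatMap block bs ≡ block (c , sumℕ (map proj₂ bs))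
concatMap-block [] _ = refl
concatMap-block {c} ((_ , l) ∷ bs) (refl , tiling) =
  trans (cong (block (c , l) ++_) (concatMap-block bs tiling)) (block-++ c l _)

-- Stated without subtraction: block i should start at T ∸ w i and be x i = w i ∸ w (i ∸ 1) long.
module Countdown (w x r : ℕ → ℕ) (w-suc : ∀ t → w (suc t) ≡ w t + x (suc t)) where

  Tiling-countdown : ∀ {T c e} t d → d ≤ t →
    (∀ k → k < d → w (t ∸ k) + r (t ∸ k) ≡ T) → c + w t ≡ T → e + w (t ∸ d) ≡ T →
    Tiling c (map (λ i → r i , x i) (applyUpTo (t ∸_) d)) e
  Tiling-countdown {c = c} {e} t zero _ _ c+wt≡T e+wt≡T = ℕₚ.+-cancelʳ-≡ (w t) c e (trans c+wt≡T (sym e+wt≡T))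
  Tiling-countdown {T} {c} (suc t) (suc d) (s≤s d≤t) starts c+w≡T e+w≡T =
    ℕₚ.+-cancelˡ-≡ (w (suc t)) _ _ (trans (starts 0 (s≤s z≤n)) (trans (sym c+w≡T) (ℕₚ.+-comm c _))) ,
    Tiling-countdown t d d≤t (λ k k<d → starts (suc k) (s≤s k<d)) next e+w≡T
    where
    next : c + x (suc t) + w t ≡ T
    next = begin
      c + x (suc t) + w t   ≡⟨ ℕₚ.+-assoc c _ _ ⟩
      c + (x (suc t) + w t) ≡⟨ cong (c +_) (trans (ℕₚ.+-comm _ (w t)) (sym (w-suc t))) ⟩
      c + w (suc t)         ≡⟨ c+w≡T ⟩
      T                     ∎
      where open ≡-Reasoning

rotationBlock : Path → ℕ → ℕ × ℕ
rotationBlock P i = RML (rot i P) , proj₁ (stepAt i P)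

module _ (P : Path) (closes : height P ≡ 1ℤ) {I : ℕ}
         (I-min : IsRightmostMinimum (sPref P) (indices (length P)) I) where

  private
    N : ℕ
    N = length P
    S : ℕ → ℤ
    S = cyclicHeight P
  open IsRightmostMinimum I-min

  I-bounds : 1 ≤ I × I ≤ N
  I-bounds = ∈-indices⁻ member

  cyclicHeight-prefix : ∀ {t} → t ≤ N → S t ≡ sPref P t
  cyclicHeight-prefix t≤N = cong height (take-++ˡ P P t≤N)

  cyclicHeight-wrap : ∀ t → S (N + t) ≡ ℤ.suc (sPref P t)
  cyclicHeight-wrap t = trans (cong height (take-length-+ t P))
    (trans (height-++ P (take t P)) (cong (ℤ._+ sPref P t) closes))

  sI≤s : ∀ {t} → 1 ≤ t → t ≤ N → sPref P I ℤ.≤ sPref P t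
  sI≤s 1≤t t≤N = minimal (∈-indices⁺ 1≤t t≤N)

  sI<s : ∀ {t} → I < t → t ≤ N → sPref P I ℤ.< sPref P t
  sI<s I<t t≤N = strict (∈-indices⁺ (ℕₚ.≤-trans (proj₁ I-bounds) (ℕₚ.<⇒≤ I<t)) t≤N) I<t

  data Half (p : ℕ) : Set where
    lower : p ≤ N → Half p
    upper : ∀ t → 1 ≤ t → t ≤ N → p ≡ N + t → Half p

  half : ∀ {p} → p ≤ N + N → Half p
  half {p} p≤ with p ℕ.≤? N
  ... | yes p≤N = lower p≤N
  ... | no p≰N = upper (p ∸ N) (ℕₚ.m<n⇒0<n∸m N<p)
                       (subst (p ∸ N ≤_) (ℕₚ.m+n∸n≡m N N) (ℕₚ.∸-monoˡ-≤ N p≤))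
                       (sym (ℕₚ.m+[n∸m]≡n (ℕₚ.<⇒≤ N<p)))
    where
    N<p : N < p
    N<p = ℕₚ.≰⇒> p≰N

  sI≤S : ∀ {p} → 1 ≤ p → p ≤ N + N → sPref P I ℤ.≤ S p
  sI≤S 1≤p p≤ with half p≤
  ... | lower p≤N = subst (_ ℤ.≤_) (sym (cyclicHeight-prefix p≤N)) (sI≤s 1≤p p≤N)
  ... | upper t 1≤t t≤N refl =
    subst (_ ℤ.≤_) (sym (cyclicHeight-wrap t)) (ℤₚ.≤-trans (sI≤s 1≤t t≤N) (ℤₚ.i≤suc[i] _))

  sI<S : ∀ {p} → I < p → p ≤ N + N → sPref P I ℤ.< S p
  sI<S I<p p≤ with half p≤
  ... | lower p≤N = subst (_ ℤ.<_) (sym (cyclicHeight-prefix p≤N)) (sI<s I<p p≤N)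
  ... | upper t 1≤t t≤N refl =
    subst (_ ℤ.<_) (sym (cyclicHeight-wrap t)) (ℤₚ.≤-<-trans (sI≤s 1≤t t≤N) (i<suc[i] _))

  suc[sI]≤S : ∀ {p} → I < p → p ≤ N + N → ℤ.suc (sPref P I) ℤ.≤ S p
  suc[sI]≤S I<p p≤ with half p≤
  ... | lower p≤N = subst (_ ℤ.≤_) (sym (cyclicHeight-prefix p≤N)) (ℤₚ.i<j⇒suc[i]≤j (sI<s I<p p≤N))
  ... | upper t 1≤t t≤N refl = subst (_ ℤ.≤_) (sym (cyclicHeight-wrap t)) (ℤₚ.suc-mono (sI≤s 1≤t t≤N))

  suc[sI]<S : ∀ {p} → N + I < p → p ≤ N + N → ℤ.suc (sPref P I) ℤ.< S p
  suc[sI]<S N+I<p p≤ with half p≤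
  ... | lower p≤N = contradiction (ℕₚ.≤-trans p≤N (ℕₚ.m≤m+n N I)) (ℕₚ.<⇒≱ N+I<p)
  ... | upper t 1≤t t≤N refl =
    subst (_ ℤ.<_) (sym (cyclicHeight-wrap t)) (ℤₚ.+-monoʳ-< 1ℤ (sI<s (ℕₚ.+-cancelˡ-< N I t N+I<p) t≤N))

  cyclicWidth-prefix : ∀ {t} → t ≤ N → cyclicWidth P t ≡ width (take t P)
  cyclicWidth-prefix t≤N = cong width (take-++ˡ P P t≤N)

  cyclicWidth-wrap : ∀ t → cyclicWidth P (N + t) ≡ width P + width (take t P)
  cyclicWidth-wrap t = trans (cong width (take-length-+ t P)) (width-++ P (take t P))

  RML-rot-≤I : ∀ {i} → 1 ≤ i → i ≤ I → width (take i P) + RML (rot i P) ≡ width (take I P)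
  RML-rot-≤I {i} 1≤i i≤I = begin
    width (take i P) + RML (rot i P)  ≡⟨ cong (_+ RML (rot i P)) (sym (cyclicWidth-prefix i≤N)) ⟩
    cyclicWidth P i + RML (rot i P)   ≡⟨ cyclicWidth-RML-rot P i≤N i≤I I≤i+N lowest strict′ ⟩
    cyclicWidth P I                   ≡⟨ cyclicWidth-prefix I≤N ⟩
    width (take I P)                  ∎
    where
    open ≡-Reasoning
    I≤N : I ≤ N
    I≤N = proj₂ I-bounds
    i≤N : i ≤ N
    i≤N = ℕₚ.≤-trans i≤I I≤N
    I≤i+N : I ≤ i + N
    I≤i+N = ℕₚ.≤-trans I≤N (ℕₚ.m≤n+m N i)
    i+N≤N+N : i + N ≤ N + N
    i+N≤N+N = ℕₚ.+-monoˡ-≤ N i≤N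
    lowest : ∀ {p} → i ≤ p → p ≤ i + N → S I ℤ.≤ S p
    lowest i≤p p≤ = subst (ℤ._≤ _) (sym (cyclicHeight-prefix I≤N))
                          (sI≤S (ℕₚ.≤-trans 1≤i i≤p) (ℕₚ.≤-trans p≤ i+N≤N+N))
    strict′ : ∀ {p} → I < p → p ≤ i + N → S I ℤ.< S p
    strict′ I<p p≤ = subst (ℤ._< _) (sym (cyclicHeight-prefix I≤N)) (sI<S I<p (ℕₚ.≤-trans p≤ i+N≤N+N))

  RML-rot->I : ∀ {i} → I < i → i ≤ N → width (take i P) + RML (rot i P) ≡ width P + width (take I P)
  RML-rot->I {i} I<i i≤N = begin
    width (take i P) + RML (rot i P)  ≡⟨ cong (_+ RML (rot i P)) (sym (cyclicWidth-prefix i≤N)) ⟩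
    cyclicWidth P i + RML (rot i P)   ≡⟨ cyclicWidth-RML-rot P i≤N i≤N+I N+I≤i+N lowest strict′ ⟩
    cyclicWidth P (N + I)             ≡⟨ cyclicWidth-wrap I ⟩
    width P + width (take I P)        ∎
    where
    open ≡-Reasoning
    i≤N+I : i ≤ N + I
    i≤N+I = ℕₚ.≤-trans i≤N (ℕₚ.m≤m+n N I)
    N+I≤i+N : N + I ≤ i + N
    N+I≤i+N = subst (N + I ≤_) (ℕₚ.+-comm N i) (ℕₚ.+-monoʳ-≤ N (ℕₚ.<⇒≤ I<i))
    i+N≤N+N : i + N ≤ N + N
    i+N≤N+N = ℕₚ.+-monoˡ-≤ N i≤N
    lowest : ∀ {p} → i ≤ p → p ≤ i + N → S (N + I) ℤ.≤ S p
    lowest i≤p p≤ = subst (ℤ._≤ _) (sym (cyclicHeight-wrap I))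
                          (suc[sI]≤S (ℕₚ.<-≤-trans I<i i≤p) (ℕₚ.≤-trans p≤ i+N≤N+N))
    strict′ : ∀ {p} → N + I < p → p ≤ i + N → S (N + I) ℤ.< S p
    strict′ N+I<p p≤ = subst (ℤ._< _) (sym (cyclicHeight-wrap I)) (suc[sI]<S N+I<p (ℕₚ.≤-trans p≤ i+N≤N+N))

  open Countdown (λ t → width (take t P)) (λ i → proj₁ (stepAt i P)) (λ i → RML (rot i P))
                 (λ t → width-take-suc t P)

  Tiling-≤I : Tiling 0 (map (rotationBlock P) (applyUpTo (I ∸_) I)) (width (take I P))
  Tiling-≤I = Tiling-countdown I I ℕₚ.≤-refl starts refl ends
    where
    starts : ∀ k → k < I → width (take (I ∸ k) P) + RML (rot (I ∸ k) P) ≡ width (take I P)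
    starts k k<I = RML-rot-≤I (ℕₚ.m<n⇒0<n∸m k<I) (ℕₚ.m∸n≤m I k)
    ends : width (take I P) + width (take (I ∸ I) P) ≡ width (take I P)
    ends = trans (cong (λ t → width (take I P) + width (take t P)) (ℕₚ.n∸n≡0 I)) (ℕₚ.+-identityʳ _)

  Tiling->I : Tiling (width (take I P)) (map (rotationBlock P) (applyUpTo (N ∸_) (N ∸ I))) (width P)
  Tiling->I = Tiling-countdown N (N ∸ I) (ℕₚ.m∸n≤m N I) starts begins ends
    where
    I≤N : I ≤ N
    I≤N = proj₂ I-bounds
    starts : ∀ k → k < N ∸ I → width (take (N ∸ k) P) + RML (rot (N ∸ k) P) ≡ width P + width (take I P)
    starts k k<N∸I = RML-rot->I (subst (_< N ∸ k) (ℕₚ.m∸[m∸n]≡n I≤N) (ℕₚ.∸-monoʳ-< k<N∸I (ℕₚ.m∸n≤m N I)))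
                                     (ℕₚ.m∸n≤m N k)
    begins : width (take I P) + width (take N P) ≡ width P + width (take I P)
    begins = trans (cong (λ X → width (take I P) + width X) (take-all N P ℕₚ.≤-refl))
                   (ℕₚ.+-comm (width (take I P)) (width P))
    ends : width P + width (take (N ∸ (N ∸ I)) P) ≡ width P + width (take I P)
    ends = cong (λ t → width P + width (take t P)) (ℕₚ.m∸[m∸n]≡n I≤N)

  Tiling-countdowns : Tiling 0 (map (rotationBlock P) (applyUpTo (I ∸_) I ++ applyUpTo (N ∸_) (N ∸ I))) (width P)
  Tiling-countdowns = subst (λ bs → Tiling 0 bs (width P))
    (sym (map-++ (rotationBlock P) (applyUpTo (I ∸_) I) (applyUpTo (N ∸_) (N ∸ I))))
    (Tiling-++ (map (rotationBlock P) (applyUpTo (I ∸_) I)) Tiling-≤I Tiling->I)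

σ-countdown : ∀ P → σ P ≡ applyUpTo (i₀ P ∸_) (i₀ P) ++ applyUpTo (length P ∸_) (length P ∸ i₀ P)
σ-countdown P = cong₂ _++_ (map-applyUpTo (λ k → k) (i₀ P ∸_) (i₀ P))
                           (map-applyUpTo (λ k → k) (length P ∸_) (length P ∸ i₀ P))

map-PRML-Γ : ∀ P → map PRML (Γ P) ≡ concatMap block (map (rotationBlock P) (σ P))
map-PRML-Γ P = begin
  map PRML (Γ P)                                         ≡⟨ map-concatMap PRML pointed (σ P) ⟩
  concatMap (map PRML ∘ pointed) (σ P)
    ≡⟨ concatMap-cong (λ i → sym (map-∘ (upTo (proj₁ (stepAt i P))))) (σ P) ⟩
  concatMap (block ∘ rotationBlock P) (σ P)              ≡⟨ sym (concatMap-map block (rotationBlock P) (σ P)) ⟩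
  concatMap block (map (rotationBlock P) (σ P))          ∎
  where
  open ≡-Reasoning
  pointed : ℕ → List Pointed
  pointed i = map (λ j → [ rot i P ︔ j ]) (upTo (proj₁ (stepAt i P)))

theorem3p12 : (n m : ℕ) → 1 ≤ n → n + 1 ≤ m → (P : Path) → IsLatticePath n m P →
    map PRML (Γ P) ≡ upTo m
theorem3p12 n m _ _ P lattice = begin
  map PRML (Γ P)                                 ≡⟨ map-PRML-Γ P ⟩
  concatMap block (map (rotationBlock P) (σ P))  ≡⟨ concatMap-block _ tiling ⟩
  block (0 , sumℕ (map proj₂ blocks))            ≡⟨ cong (λ l → block (0 , l)) (Tiling-length _ tiling) ⟩
  map (0 +_) (upTo m)                            ≡⟨ map-id (upTo m) ⟩
  upTo m                                         ∎
  where
  open ≡-Reasoning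
  open IsLatticePath lattice
  blocks : List (ℕ × ℕ)
  blocks = map (rotationBlock P) (σ P)
  nonempty : 1 ≤ length P
  nonempty = subst (1 ≤_) (sym len) (s≤s z≤n)
  tiling : Tiling 0 blocks m
  tiling = subst₂ (λ is e → Tiling 0 (map (rotationBlock P) is) e) (sym (σ-countdown P)) uSum
    (Tiling-countdowns P vSum (i₀-isRightmostMinimum P nonempty))
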